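{- Let $p$ be a prime and $m\ge 2$. Then $$(p-2)\,\phi(C_{p^{m-1}}\times C_p)<\phi(C_{p^m})<p\,\phi(C_{p^{m-1}}\times C_p).$$
   Context: $C_k$ is the cyclic group of order $k$, $o(g)$ the order of $g$, $\phi$ applied to an integer is Euler's totient function, and for a finite group $G$, $\phi(G)=\sum_{g\in G}\phi(o(g))$. -}

module Defs where

open import Data.Nat using (ℕ; zero; suc; _+_; _*_; _≟_)
open import Data.Nat.DivMod using (_%_)
open import Data.Nat.GCD using (gcd)
open import Data.List using (List; []; _∷_; map; filter; upTo; length; concatMap)
open import Data.Nat.ListAction using (sum)
open import Data.Product using (_×_; _,_)
open import Relation.Binary.Definitions using (DecidableEquality)
open import Relation.Binary.PropositionalEquality using (_≡_)
import Data.Product.Properties as PP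

-- A finite group given concretely: carrier, operation, identity,
-- decidable equality, and the list of all its elements (each exactly once).
record FinGroup : Set₁ where
  field
    Carrier  : Set
    _∙_      : Carrier → Carrier → Carrier
    ε        : Carrier
    _≟G_     : DecidableEquality Carrier
    elements : List Carrier

  pow : ℕ → Carrier → Carrier
  pow zero    g = ε
  pow (suc n) g = g ∙ pow n g

  -- order of g: least n with 1 ≤ n ≤ |G| and g^n = ε
  -- (such n always exists in a finite group; 0 is an unreachable default)
  firstOr0 : List ℕ → ℕ
  firstOr0 []      = 0
  firstOr0 (n ∷ _) = n

  order : Carrier → ℕ
  order g = firstOr0 (filter (λ n → pow n g ≟G ε) (map suc (upTo (length elements))))

open FinGroup public

totient : ℕ → ℕ
totient n = length (filter (λ i → gcd i n ≟ 1) (map suc (upTo n)))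

phiG : FinGroup → ℕ
phiG G = sum (map (λ g → totient (order G g)) (elements G))

addMod : ℕ → ℕ → ℕ → ℕ
addMod zero    a b = 0
addMod (suc k) a b = (a + b) % suc k

Cyc : ℕ → FinGroup
Cyc k = record
  { Carrier  = ℕ
  ; _∙_      = addMod k
  ; ε        = 0
  ; _≟G_     = _≟_
  ; elements = upTo k
  }

_×G_ : FinGroup → FinGroup → FinGroup
G ×G H = record
  { Carrier  = Carrier G × Carrier H
  ; _∙_      = λ { (a , b) (c , d) → (_∙_ G a c , _∙_ H b d) }
  ; ε        = (ε G , ε H)
  ; _≟G_     = PP.≡-dec (_≟G_ G) (_≟G_ H)
  ; elements = concatMap (λ a → map (λ b → (a , b)) (elements H)) (elements G)
  }

-- Split C_{p^(m+1)} and C_{p^(m+1)} × C_p according to whether the first coordinate is a multiple of p.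
-- The multiples h·p behave like h in C_{p^m} (resp. C_{p^m} × C_p), with the same orders, while every other
-- element has order p^(m+1), whose totient is p^m (p − 1).  Hence
--   φ(C_{p^(m+1)}) = φ(C_{p^m}) + φ(p^(m+1))²  and  φ(C_{p^(m+1)} × C_p) = φ(C_{p^m} × C_p) + p·φ(p^(m+1))²,
-- and since φ(C_1 × C_p) = φ(C_p), induction on m gives
--   p·φ(C_{p^(m-1)} × C_p) = φ(C_{p^m}) + (p − 1)·φ(C_p).
-- This is the upper bound; the lower bound, even with p − 1 in place of p − 2, follows because
-- (p − 1)·φ(C_p) < φ(C_p × C_p) ≤ φ(C_{p^(m-1)} × C_p).

module Submission where

open import Defs
open import Data.List using (List; []; _∷_; _++_; map; filter; upTo; applyUpTo; length; concatMap)
open import Data.List.Properties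
  using (filter-accept; filter-reject; length-upTo; length-++; length-map; map-++; map-∘; map-upTo)
open import Data.Nat
  using (ℕ; zero; suc; _+_; _*_; _∸_; _^_; _≤_; _<_; _≟_; z≤n; s≤s; s≤s⁻¹; z<s; NonZero; nonTrivial⇒n>1; >-nonZero; >-nonZero⁻¹)
open import Data.Nat.Coprimality using (Coprime; coprime-divisor; coprime⇒gcd≡1)
import Data.Nat.Coprimality as Coprime
open import Data.Nat.Divisibility
open import Data.Nat.DivMod using (_%_; %-distribˡ-+; m%n%n≡m%n; n%1≡0)
open import Data.Nat.GCD using (gcd; gcd-identityˡ; gcd[m,n]∣m; gcd-greatest)
open import Data.Nat.ListAction using (sum)
open import Data.Nat.ListAction.Properties using (sum-++)
open import Data.Nat.Primality using (Prime; prime⇒irreducible; prime⇒nonTrivial; ¬prime[1])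
open import Data.Nat.Properties
open import Algebra.Properties.CommutativeSemigroup +-commutativeSemigroup using (interchange)
open import Data.Nat.Tactic.RingSolver using (solve-∀)
open import Data.Product using (_×_; _,_; proj₁; proj₂)
open import Data.Product.Function.NonDependent.Propositional using (_×-⇔_)
open import Data.Product.Properties using (,-injectiveˡ; ,-injectiveʳ)
open import Data.Sum using (inj₁; inj₂)
open import Function using (_∘_; _⇔_; mk⇔; Equivalence)
open import Function.Properties.Equivalence using () renaming (refl to ⇔-refl; sym to ⇔-sym; trans to ⇔-trans)
open import Relation.Binary.Definitions using (tri<; tri≈; tri>)
open import Relation.Binary.PropositionalEquality
open import Relation.Nullary using (¬_; Dec; yes; no; contradiction)
open import Relation.Unary using (Decidable)

open Equivalence using (to; from)

¬∣-offset : ∀ h {k r} → r < k → ¬ suc k ∣ h * suc k + suc r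
¬∣-offset h r<k p∣ = <⇒≱ r<k (s≤s⁻¹ (∣⇒≤ (∣m+n∣m⇒∣n p∣ (n∣m*n h))))

-- Opaque: otherwise unification unfolds sums of totients of orders into expensive normalisation.
opaque
  ∑< : ℕ → (ℕ → ℕ) → ℕ
  ∑< n f = sum (applyUpTo f n)

  sum-map-upTo : ∀ f n → sum (map f (upTo n)) ≡ ∑< n f
  sum-map-upTo f n = cong sum (map-upTo f n)

  ∑<-cong : ∀ n {f g : ℕ → ℕ} → (∀ i → i < n → f i ≡ g i) → ∑< n f ≡ ∑< n g
  ∑<-cong zero    f≗g = refl
  ∑<-cong (suc n) f≗g = cong₂ _+_ (f≗g 0 z<s) (∑<-cong n (λ i i<n → f≗g (suc i) (s≤s i<n)))

  ∑<-const : ∀ n c → ∑< n (λ _ → c) ≡ n * c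
  ∑<-const zero    c = refl
  ∑<-const (suc n) c = cong (c +_) (∑<-const n c)

  ∑<-+ : ∀ n (f g : ℕ → ℕ) → ∑< n (λ i → f i + g i) ≡ ∑< n f + ∑< n g
  ∑<-+ zero    f g = refl
  ∑<-+ (suc n) f g =
    trans (cong (f 0 + g 0 +_) (∑<-+ n (f ∘ suc) (g ∘ suc))) (interchange (f 0) (g 0) _ _)

  ∑<-suc : ∀ n f → ∑< (suc n) f ≡ ∑< n f + f n
  ∑<-suc zero    f = +-identityʳ (f 0)
  ∑<-suc (suc n) f = trans (cong (f 0 +_) (∑<-suc n (f ∘ suc))) (sym (+-assoc (f 0) _ _))

  ∑<-rotate : ∀ n f → f 0 ≡ f n → ∑< n (f ∘ suc) ≡ ∑< n f
  ∑<-rotate n f f0≡fn = +-cancelˡ-≡ (f 0) _ _ (begin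
    f 0 + ∑< n (f ∘ suc) ≡⟨ ∑<-suc n f ⟩
    ∑< n f + f n         ≡⟨ cong (∑< n f +_) (sym f0≡fn) ⟩
    ∑< n f + f 0         ≡⟨ +-comm (∑< n f) (f 0) ⟩
    f 0 + ∑< n f         ∎)
    where open ≡-Reasoning

  ∑<-++ : ∀ m n f → ∑< (m + n) f ≡ ∑< m f + ∑< n (λ i → f (m + i))
  ∑<-++ zero    n f = refl
  ∑<-++ (suc m) n f = trans (cong (f 0 +_) (∑<-++ m n (f ∘ suc))) (sym (+-assoc (f 0) _ _))

  ∑<-* : ∀ m n f → ∑< (m * n) f ≡ ∑< m (λ h → ∑< n (λ r → f (h * n + r)))
  ∑<-* zero    n f = refl
  ∑<-* (suc m) n f = begin
    ∑< (n + m * n) f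
      ≡⟨ ∑<-++ n (m * n) f ⟩
    ∑< n f + ∑< (m * n) (λ i → f (n + i))
      ≡⟨ cong (∑< n f +_) (∑<-* m n (λ i → f (n + i))) ⟩
    ∑< n f + ∑< m (λ h → ∑< n (λ r → f (n + (h * n + r))))
      ≡⟨ cong (∑< n f +_) (∑<-cong m λ h _ → ∑<-cong n λ r _ → cong f (sym (+-assoc n (h * n) r))) ⟩
    ∑< n f + ∑< m (λ h → ∑< n (λ r → f (n + h * n + r)))
      ∎
    where open ≡-Reasoning

  ∑<-multiples : ∀ m k {f : ℕ → ℕ} {c} → (∀ i → ¬ suc k ∣ i → f i ≡ c) →
    ∑< (m * suc k) f ≡ ∑< m (λ h → f (h * suc k)) + m * (k * c)
  ∑<-multiples m k {f} {c} f-off = begin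
    ∑< (m * p) f                                 ≡⟨ ∑<-* m p f ⟩
    ∑< m (λ h → ∑< p (λ r → f (h * p + r)))      ≡⟨ ∑<-cong m (λ h _ → block h) ⟩
    ∑< m (λ h → f (h * p) + k * c)               ≡⟨ ∑<-+ m _ _ ⟩
    ∑< m (λ h → f (h * p)) + ∑< m (λ _ → k * c)  ≡⟨ cong (∑< m (λ h → f (h * p)) +_) (∑<-const m (k * c)) ⟩
    ∑< m (λ h → f (h * p)) + m * (k * c)         ∎
    where
    open ≡-Reasoning
    p : ℕ
    p = suc k
    block : ∀ h → ∑< p (λ r → f (h * p + r)) ≡ f (h * p) + k * c
    block h = cong₂ _+_ (cong f (+-identityʳ (h * p)))
      (trans (∑<-cong k (λ r r<k → f-off _ (¬∣-offset h r<k))) (∑<-const k c))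

indicator : ∀ {A : Set} → Dec A → ℕ
indicator (yes _) = 1
indicator (no _)  = 0

indicator-yes : ∀ {A : Set} (a? : Dec A) → A → indicator a? ≡ 1
indicator-yes (yes _) _ = refl
indicator-yes (no ¬a) a = contradiction a ¬a

indicator-no : ∀ {A : Set} (a? : Dec A) → ¬ A → indicator a? ≡ 0
indicator-no (yes a) ¬a = contradiction a ¬a
indicator-no (no _)  _  = refl

length-filter≡sum-indicator : ∀ {A : Set} {P : A → Set} (P? : Decidable P) xs →
  length (filter P? xs) ≡ sum (map (indicator ∘ P?) xs)
length-filter≡sum-indicator P? []       = refl
length-filter≡sum-indicator P? (x ∷ xs) with P? x
... | yes _ = cong suc (length-filter≡sum-indicator P? xs)
... | no _  = length-filter≡sum-indicator P? xs

gcd[n,n]≡n : ∀ n → gcd n n ≡ n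
gcd[n,n]≡n n = ∣-antisym (gcd[m,n]∣m n n) (gcd-greatest ∣-refl ∣-refl)

-- Counting over 0 … n − 1 instead of 1 … n is harmless: gcd 0 n = n = gcd n n.
totient≡∑< : ∀ n → totient n ≡ ∑< n (λ i → indicator (gcd i n ≟ 1))
totient≡∑< n = begin
  length (filter (λ i → gcd i n ≟ 1) (map suc (upTo n)))
    ≡⟨ length-filter≡sum-indicator (λ i → gcd i n ≟ 1) (map suc (upTo n)) ⟩
  sum (map c (map suc (upTo n)))  ≡⟨ cong sum (sym (map-∘ (upTo n))) ⟩
  sum (map (c ∘ suc) (upTo n))    ≡⟨ sum-map-upTo (c ∘ suc) n ⟩
  ∑< n (c ∘ suc)                  ≡⟨ ∑<-rotate n c (cong (λ d → indicator (d ≟ 1)) gcd[0,n]≡gcd[n,n]) ⟩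
  ∑< n c                          ∎
  where
  open ≡-Reasoning
  c : ℕ → ℕ
  c i = indicator (gcd i n ≟ 1)
  gcd[0,n]≡gcd[n,n] : gcd 0 n ≡ gcd n n
  gcd[0,n]≡gcd[n,n] = trans (gcd-identityˡ n) (sym (gcd[n,n]≡n n))

Annihilates : (G : FinGroup) → Carrier G → ℕ → Set
Annihilates G g j = pow G j g ≡ ε G

record Least≥ (s : ℕ) (P : ℕ → Set) (n : ℕ) : Set where
  field
    lower   : s ≤ n
    holds   : P n
    minimal : ∀ {j} → s ≤ j → j < n → ¬ P j

open Least≥

Least≥-unique : ∀ {s P m n} → Least≥ s P m → Least≥ s P n → m ≡ n
Least≥-unique {m = m} {n} lm ln with <-cmp m n
... | tri< m<n _ _ = contradiction (holds lm) (minimal ln (lower lm) m<n)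
... | tri≈ _ m≡n _ = m≡n
... | tri> _ _ n<m = contradiction (holds ln) (minimal lm (lower ln) n<m)

module _ (G : FinGroup) {P : ℕ → Set} (P? : Decidable P) where

  FirstIsLeast≥ : ℕ → ℕ → List ℕ → Set
  FirstIsLeast≥ s L xs = Least≥ s P (firstOr0 G (filter P? xs)) × firstOr0 G (filter P? xs) < s + L

  -- f i = s + i rather than s +_ itself, so that the tail f ∘ suc is again of this form.
  firstOr0-filter-least : ∀ L s (f : ℕ → ℕ) → (∀ i → f i ≡ s + i) →
    ∀ {k} → s ≤ k → k < s + L → P k → FirstIsLeast≥ s L (applyUpTo f L)
  firstOr0-filter-least zero s f f≗ s≤k k<s+0 _ =
    contradiction (≤-<-trans s≤k (subst (_ <_) (+-identityʳ s) k<s+0)) (n≮n s)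
  firstOr0-filter-least (suc L) s f f≗ {k} s≤k k<s+1+L Pk = cases (P? (f 0))
    where
    f0≡s : f 0 ≡ s
    f0≡s = trans (f≗ 0) (+-identityʳ s)

    cases : Dec (P (f 0)) → FirstIsLeast≥ s (suc L) (applyUpTo f (suc L))
    cases (yes P[f0]) rewrite filter-accept P? {xs = applyUpTo (f ∘ suc) L} P[f0] =
      record { lower = ≤-reflexive (sym f0≡s) ; holds = P[f0]
             ; minimal = λ s≤j j<f0 → contradiction (≤-<-trans s≤j (subst (_ <_) f0≡s j<f0)) (n≮n s) }
      , subst (_< s + suc L) (sym f0≡s) (m<m+n s z<s)
    cases (no ¬P[f0]) rewrite filter-reject P? {xs = applyUpTo (f ∘ suc) L} ¬P[f0] =
      record { lower = ≤-trans (n≤1+n s) (lower (proj₁ tail)) ; holds = holds (proj₁ tail)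
             ; minimal = minimal′ }
      , subst (firstOr0 G (filter P? (applyUpTo (f ∘ suc) L)) <_) (sym (+-suc s L)) (proj₂ tail)
      where
      ¬Ps : ¬ P s
      ¬Ps = ¬P[f0] ∘ subst P (sym f0≡s)
      1+s≤k : suc s ≤ k
      1+s≤k with m≤n⇒m<n∨m≡n s≤k
      ... | inj₁ s<k  = s<k
      ... | inj₂ refl = contradiction Pk ¬Ps
      tail : FirstIsLeast≥ (suc s) L (applyUpTo (f ∘ suc) L)
      tail = firstOr0-filter-least L (suc s) (f ∘ suc) (λ i → trans (f≗ (suc i)) (+-suc s i))
               1+s≤k (subst (k <_) (+-suc s L) k<s+1+L) Pk
      minimal′ : ∀ {j} → s ≤ j → j < firstOr0 G (filter P? (applyUpTo (f ∘ suc) L)) → ¬ P j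
      minimal′ s≤j with m≤n⇒m<n∨m≡n s≤j
      ... | inj₁ s<j  = minimal (proj₁ tail) s<j
      ... | inj₂ refl = λ _ → ¬Ps

module _ (G : FinGroup) (g : Carrier G) where

  order-least : ∀ {k} → 1 ≤ k → k ≤ length (elements G) → Annihilates G g k →
    Least≥ 1 (Annihilates G g) (order G g) × order G g ≤ length (elements G)
  order-least 1≤k k≤|G| ann rewrite map-upTo suc (length (elements G)) =
    let least , bound = firstOr0-filter-least G (λ n → _≟G_ G (pow G n g) (ε G))
                          (length (elements G)) 1 suc (λ _ → refl) 1≤k (s≤s k≤|G|) ann
    in least , s≤s⁻¹ bound

  order≡ : ∀ {n} → Least≥ 1 (Annihilates G g) n → n ≤ length (elements G) → order G g ≡ n
  order≡ least n≤|G| = Least≥-unique (proj₁ (order-least (lower least) n≤|G| (holds least))) least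

  order≡exponent : ∀ {n} → 1 ≤ n → n ≤ length (elements G) → (∀ j → Annihilates G g j ⇔ n ∣ j) →
    order G g ≡ n
  order≡exponent {n} 1≤n n≤|G| ann⇔ = order≡ least n≤|G|
    where
    least : Least≥ 1 (Annihilates G g) n
    least = record
      { lower   = 1≤n
      ; holds   = from (ann⇔ n) ∣-refl
      ; minimal = λ {j} 1≤j j<n ann → <⇒≱ j<n (∣⇒≤ {{>-nonZero 1≤j}} (to (ann⇔ j) ann)) }

order-cong : ∀ G H {g h} → (∀ j → Annihilates G g j ⇔ Annihilates H h j) →
  length (elements H) ≤ length (elements G) →
  ∀ {k} → 1 ≤ k → k ≤ length (elements H) → Annihilates H h k → order G g ≡ order H h
order-cong G H {g} {h} ann⇔ |H|≤|G| 1≤k k≤|H| ann = order≡ G g least (≤-trans o≤|H| |H|≤|G|)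
  where
  least-H = order-least H h 1≤k k≤|H| ann
  o≤|H| = proj₂ least-H
  least : Least≥ 1 (Annihilates G g) (order H h)
  least = record
    { lower   = lower (proj₁ least-H)
    ; holds   = from (ann⇔ (order H h)) (holds (proj₁ least-H))
    ; minimal = λ {j} 1≤j j<o ann → minimal (proj₁ least-H) 1≤j j<o (to (ann⇔ j) ann) }

pow-Cyc : ∀ n .{{_ : NonZero n}} j g → pow (Cyc n) j g ≡ (j * g) % n
pow-Cyc (suc n) zero    g = refl
pow-Cyc (suc n) (suc j) g = begin
  (g + pow (Cyc (suc n)) j g) % suc n     ≡⟨ cong (λ x → (g + x) % suc n) (pow-Cyc (suc n) j g) ⟩
  (g + (j * g) % suc n) % suc n           ≡⟨ %-distribˡ-+ g ((j * g) % suc n) (suc n) ⟩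
  (g % suc n + (j * g) % suc n % suc n) % suc n
    ≡⟨ cong (λ x → (g % suc n + x) % suc n) (m%n%n≡m%n (j * g) (suc n)) ⟩
  (g % suc n + (j * g) % suc n) % suc n   ≡⟨ sym (%-distribˡ-+ g (j * g) (suc n)) ⟩
  (g + j * g) % suc n                     ∎
  where open ≡-Reasoning

annihilates-Cyc⇔ : ∀ n .{{_ : NonZero n}} j g → Annihilates (Cyc n) g j ⇔ n ∣ j * g
annihilates-Cyc⇔ n j g = ⇔-trans (≡-⇔ (pow-Cyc n j g)) (m%n≡0⇔n∣m (j * g) n)
  where
  ≡-⇔ : ∀ {x y} → x ≡ y → (x ≡ 0) ⇔ (y ≡ 0)
  ≡-⇔ x≡y = mk⇔ (trans (sym x≡y)) (trans x≡y)

pow-×G : ∀ G H j a b → pow (G ×G H) j (a , b) ≡ (pow G j a , pow H j b)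
pow-×G G H zero    a b = refl
pow-×G G H (suc j) a b rewrite pow-×G G H j a b = refl

annihilates-×G⇔ : ∀ G H j a b →
  Annihilates (G ×G H) (a , b) j ⇔ (Annihilates G a j × Annihilates H b j)
annihilates-×G⇔ G H j a b = mk⇔
  (λ ann → let ann′ = trans (sym (pow-×G G H j a b)) ann in ,-injectiveˡ ann′ , ,-injectiveʳ ann′)
  (λ (annG , annH) → trans (pow-×G G H j a b) (cong₂ _,_ annG annH))

annihilates-Cyc×Cyc⇔ : ∀ m n .{{_ : NonZero m}} .{{_ : NonZero n}} j a b →
  Annihilates (Cyc m ×G Cyc n) (a , b) j ⇔ (m ∣ j * a × n ∣ j * b)
annihilates-Cyc×Cyc⇔ m n j a b =
  ⇔-trans (annihilates-×G⇔ (Cyc m) (Cyc n) j a b) (annihilates-Cyc⇔ m j a ×-⇔ annihilates-Cyc⇔ n j b)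

length-×G : ∀ G H → length (elements (G ×G H)) ≡ length (elements G) * length (elements H)
length-×G G H = go (elements G)
  where
  go : ∀ xs → length (concatMap (λ a → map (a ,_) (elements H)) xs) ≡ length xs * length (elements H)
  go []       = refl
  go (x ∷ xs) = trans (length-++ (map (x ,_) (elements H)))
                      (cong₂ _+_ (length-map (x ,_) (elements H)) (go xs))

phiG-×G : ∀ G H → phiG (G ×G H) ≡
  sum (map (λ a → sum (map (λ b → totient (order (G ×G H) (a , b))) (elements H))) (elements G))
phiG-×G G H = go (elements G)
  where
  F = λ x → totient (order (G ×G H) x)
  go : ∀ xs → sum (map F (concatMap (λ a → map (a ,_) (elements H)) xs)) ≡
              sum (map (λ a → sum (map (λ b → F (a , b)) (elements H))) xs)
  go []       = refl
  go (x ∷ xs) = begin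
    sum (map F (map (x ,_) (elements H) ++ rest))        ≡⟨ cong sum (map-++ F (map (x ,_) (elements H)) rest) ⟩
    sum (map F (map (x ,_) (elements H)) ++ map F rest)  ≡⟨ sum-++ (map F (map (x ,_) (elements H))) (map F rest) ⟩
    sum (map F (map (x ,_) (elements H))) + sum (map F rest)
      ≡⟨ cong₂ _+_ (cong sum (sym (map-∘ (elements H)))) (go xs) ⟩
    sum (map (λ b → F (x , b)) (elements H)) + sum (map (λ a → sum (map (λ b → F (a , b)) (elements H))) xs) ∎
    where
    open ≡-Reasoning
    rest = concatMap (λ a → map (a ,_) (elements H)) xs

phiG-Cyc : ∀ n → phiG (Cyc n) ≡ ∑< n (λ g → totient (order (Cyc n) g))
phiG-Cyc n = sum-map-upTo _ n

phiG-Cyc×Cyc : ∀ m n →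
  phiG (Cyc m ×G Cyc n) ≡ ∑< m (λ a → ∑< n (λ b → totient (order (Cyc m ×G Cyc n) (a , b))))
phiG-Cyc×Cyc m n = trans (phiG-×G (Cyc m) (Cyc n))
  (trans (sum-map-upTo _ m) (∑<-cong m (λ a _ → sum-map-upTo _ n)))

pow-Cyc1 : ∀ j g → pow (Cyc 1) j g ≡ 0
pow-Cyc1 zero    g = refl
pow-Cyc1 (suc j) g = n%1≡0 (g + pow (Cyc 1) j g)

order-Cyc1×G : ∀ H b {k} → 1 ≤ k → k ≤ length (elements H) → Annihilates H b k →
  order (Cyc 1 ×G H) (0 , b) ≡ order H b
order-Cyc1×G H b = order-cong (Cyc 1 ×G H) H ann⇔
  (≤-reflexive (sym (trans (length-×G (Cyc 1) H) (+-identityʳ _))))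
  where
  ann⇔ : ∀ j → Annihilates (Cyc 1 ×G H) (0 , b) j ⇔ Annihilates H b j
  ann⇔ j = ⇔-trans (annihilates-×G⇔ (Cyc 1) H j 0 b) (mk⇔ proj₂ (pow-Cyc1 j 0 ,_))

phiG-Cyc1×Cyc : ∀ n .{{_ : NonZero n}} → phiG (Cyc 1 ×G Cyc n) ≡ phiG (Cyc n)
phiG-Cyc1×Cyc n = begin
  phiG (Cyc 1 ×G Cyc n)                      ≡⟨ phiG-×G (Cyc 1) (Cyc n) ⟩
  sum (map (totient ∘ order₀) (upTo n)) + 0  ≡⟨ +-identityʳ _ ⟩
  sum (map (totient ∘ order₀) (upTo n))      ≡⟨ sum-map-upTo _ n ⟩
  ∑< n (totient ∘ order₀)                    ≡⟨ ∑<-cong n (λ b _ → cong totient (order₀≡ b)) ⟩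
  ∑< n (totient ∘ order (Cyc n))             ≡⟨ sym (phiG-Cyc n) ⟩
  phiG (Cyc n)                               ∎
  where
  open ≡-Reasoning
  order₀ : ℕ → ℕ
  order₀ b = order (Cyc 1 ×G Cyc n) (0 , b)
  order₀≡ : ∀ b → order₀ b ≡ order (Cyc n) b
  order₀≡ b = order-Cyc1×G (Cyc n) b (>-nonZero⁻¹ n) (≤-reflexive (sym (length-upTo n)))
                (from (annihilates-Cyc⇔ n n b) (m∣m*n b))

coprime-*ˡ : ∀ {a b n} → Coprime a n → Coprime b n → Coprime (a * b) n
coprime-*ˡ {a} a⊥n b⊥n {d} (d∣ab , d∣n) = b⊥n (coprime-divisor d⊥a d∣ab , d∣n)
  where
  d⊥a : Coprime d a
  d⊥a (e∣d , e∣a) = a⊥n (e∣a , ∣-trans e∣d d∣n)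

coprime-^ˡ : ∀ {m n} → Coprime m n → ∀ e → Coprime (m ^ e) n
coprime-^ˡ m⊥n zero    (d∣1 , _) = ∣1⇒≡1 d∣1
coprime-^ˡ m⊥n (suc e) = coprime-*ˡ m⊥n (coprime-^ˡ m⊥n e)

c*m∣j*[h*c]⇔m∣j*h : ∀ c .{{_ : NonZero c}} m j h → c * m ∣ j * (h * c) ⇔ m ∣ j * h
c*m∣j*[h*c]⇔m∣j*h c m j h = mk⇔
  (λ cm∣ → *-cancelˡ-∣ c (subst (c * m ∣_) (j*[h*c]≡c*[j*h] j h c) cm∣))
  (λ m∣ → subst (c * m ∣_) (sym (j*[h*c]≡c*[j*h] j h c)) (*-monoʳ-∣ c m∣))
  where
  j*[h*c]≡c*[j*h] : ∀ j h c → j * (h * c) ≡ c * (j * h)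
  j*[h*c]≡c*[j*h] = solve-∀

module _ {p : ℕ} (isPrime : Prime p) where

  ¬∣⇒coprime : ∀ {x} → ¬ p ∣ x → Coprime p x
  ¬∣⇒coprime p∤x (d∣p , d∣x) with prime⇒irreducible isPrime d∣p
  ... | inj₁ d≡1  = d≡1
  ... | inj₂ refl = contradiction d∣x p∤x

  p^m∣j*x⇒p^m∣j : ∀ m {j x} → ¬ p ∣ x → p ^ m ∣ j * x → p ^ m ∣ j
  p^m∣j*x⇒p^m∣j m {j} {x} p∤x p^m∣jx =
    coprime-divisor (coprime-^ˡ (¬∣⇒coprime p∤x) m) (subst (p ^ m ∣_) (*-comm j x) p^m∣jx)

  gcd[x,p^m]≡1 : ∀ m {x} → ¬ p ∣ x → gcd x (p ^ m) ≡ 1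
  gcd[x,p^m]≡1 m p∤x = coprime⇒gcd≡1 (Coprime.sym (coprime-^ˡ (¬∣⇒coprime p∤x) m))

  gcd[x,p^[1+m]]≢1 : ∀ m {x} → p ∣ x → gcd x (p ^ suc m) ≢ 1
  gcd[x,p^[1+m]]≢1 m p∣x gcd≡1 =
    ¬prime[1] (subst Prime (∣1⇒≡1 (subst (p ∣_) gcd≡1 (gcd-greatest p∣x (m∣m*n (p ^ m))))) isPrime)

k*[1+k*k]<1+k*k+[1+k]*[k*k] : ∀ k → k * (1 + k * k) < 1 + k * k + suc k * (k * k)
k*[1+k*k]<1+k*k+[1+k]*[k*k] zero    = z<s
k*[1+k*k]<1+k*k+[1+k]*[k*k] (suc q) =
  ≤-trans (m≤m+n _ ((1 + q) * (1 + q) + (1 + q) * q)) (≤-reflexive (identity q))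
  where
  identity : ∀ q → suc ((1 + q) * (1 + (1 + q) * (1 + q))) + ((1 + q) * (1 + q) + (1 + q) * q)
                   ≡ 1 + (1 + q) * (1 + q) + (2 + q) * ((1 + q) * (1 + q))
  identity = solve-∀

module _ {k : ℕ} (isPrime : Prime (suc k)) where

  private
    p : ℕ
    p = suc k

  φCp^ φCp^×Cp : ℕ → ℕ
  φCp^    m = phiG (Cyc (p ^ m))
  φCp^×Cp m = phiG (Cyc (p ^ m) ×G Cyc p)

  annihilates-Cp^⇔ : ∀ m j g → Annihilates (Cyc (p ^ m)) g j ⇔ p ^ m ∣ j * g
  annihilates-Cp^⇔ m = annihilates-Cyc⇔ (p ^ m) {{m^n≢0 p m}}

  annihilates-Cp^×Cp⇔ : ∀ m j a b →
    Annihilates (Cyc (p ^ m) ×G Cyc p) (a , b) j ⇔ (p ^ m ∣ j * a × p ∣ j * b)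
  annihilates-Cp^×Cp⇔ m = annihilates-Cyc×Cyc⇔ (p ^ m) p {{m^n≢0 p m}}

  totient-p^[1+m] : ∀ m → totient (p ^ suc m) ≡ p ^ m * k
  totient-p^[1+m] m = begin
    totient N                              ≡⟨ totient≡∑< N ⟩
    ∑< N c                                 ≡⟨ cong (λ n → ∑< n c) (*-comm p M) ⟩
    ∑< (M * p) c                           ≡⟨ ∑<-multiples M k c-off ⟩
    ∑< M (λ h → c (h * p)) + M * (k * 1)   ≡⟨ cong₂ _+_ (∑<-cong M (λ h _ → c-multiple h))
                                                        (cong (M *_) (*-identityʳ k)) ⟩
    ∑< M (λ _ → 0) + M * k                 ≡⟨ cong (_+ M * k) (trans (∑<-const M 0) (*-zeroʳ M)) ⟩
    M * k                                  ∎
    where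
    open ≡-Reasoning
    N M : ℕ
    N = p ^ suc m
    M = p ^ m
    c : ℕ → ℕ
    c i = indicator (gcd i N ≟ 1)
    c-off : ∀ i → ¬ p ∣ i → c i ≡ 1
    c-off i p∤i = indicator-yes _ (gcd[x,p^m]≡1 isPrime (suc m) p∤i)
    c-multiple : ∀ h → c (h * p) ≡ 0
    c-multiple h = indicator-no _ (gcd[x,p^[1+m]]≢1 isPrime m (n∣m*n h))

  order-Cyc-¬∣ : ∀ m {g} → ¬ p ∣ g → order (Cyc (p ^ m)) g ≡ p ^ m
  order-Cyc-¬∣ m {g} p∤g =
    order≡exponent (Cyc (p ^ m)) g (m^n>0 p m) (≤-reflexive (sym (length-upTo (p ^ m))))
    λ j → ⇔-trans (annihilates-Cp^⇔ m j g) (mk⇔ (p^m∣j*x⇒p^m∣j isPrime m p∤g) (∣m⇒∣m*n g))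

  order-Cyc-multiple : ∀ m h → order (Cyc (p ^ suc m)) (h * p) ≡ order (Cyc (p ^ m)) h
  order-Cyc-multiple m h = order-cong (Cyc (p ^ suc m)) (Cyc (p ^ m)) ann⇔
    (subst₂ _≤_ (sym (length-upTo M)) (sym (length-upTo (p ^ suc m))) (m≤n*m M p))
    (m^n>0 p m) (≤-reflexive (sym (length-upTo M))) (from (annihilates-Cp^⇔ m M h) (m∣m*n h))
    where
    M = p ^ m
    ann⇔ : ∀ j → Annihilates (Cyc (p ^ suc m)) (h * p) j ⇔ Annihilates (Cyc M) h j
    ann⇔ j = ⇔-trans (annihilates-Cp^⇔ (suc m) j (h * p))
               (⇔-trans (c*m∣j*[h*c]⇔m∣j*h p M j h) (⇔-sym (annihilates-Cp^⇔ m j h)))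

  length-Cyc×Cp : ∀ m → length (elements (Cyc (p ^ m) ×G Cyc p)) ≡ p ^ m * p
  length-Cyc×Cp m = trans (length-×G (Cyc (p ^ m)) (Cyc p)) (cong₂ _*_ (length-upTo (p ^ m)) (length-upTo p))

  order-Cyc×Cp-¬∣ : ∀ m {a} b → ¬ p ∣ a → order (Cyc (p ^ suc m) ×G Cyc p) (a , b) ≡ p ^ suc m
  order-Cyc×Cp-¬∣ m {a} b p∤a = order≡exponent (Cyc N ×G Cyc p) (a , b) (m^n>0 p (suc m))
    (≤-trans (m≤m*n N p) (≤-reflexive (sym (length-Cyc×Cp (suc m)))))
    λ j → ⇔-trans (annihilates-Cp^×Cp⇔ (suc m) j a b)
            (mk⇔ (p^m∣j*x⇒p^m∣j isPrime (suc m) p∤a ∘ proj₁)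
                 (λ N∣j → ∣m⇒∣m*n a N∣j , ∣m⇒∣m*n b (∣-trans (m∣m*n (p ^ m)) N∣j)))
    where N = p ^ suc m

  order-Cyc×Cp-multiple : ∀ m h b →
    order (Cyc (p ^ suc m) ×G Cyc p) (h * p , b) ≡ order (Cyc (p ^ m) ×G Cyc p) (h , b)
  order-Cyc×Cp-multiple m h b = order-cong (Cyc (p ^ suc m) ×G Cyc p) (Cyc M ×G Cyc p) ann⇔
    (subst₂ _≤_ (sym (length-Cyc×Cp m)) (sym (length-Cyc×Cp (suc m))) (*-monoˡ-≤ p (m≤n*m M p)))
    (m^n>0 p (suc m)) (≤-reflexive (trans (*-comm p M) (sym (length-Cyc×Cp m))))
    (from (annihilates-Cp^×Cp⇔ m (p * M) h b) (∣m⇒∣m*n h (n∣m*n p) , ∣m⇒∣m*n b (m∣m*n M)))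
    where
    M = p ^ m
    ann⇔ : ∀ j →
      Annihilates (Cyc (p ^ suc m) ×G Cyc p) (h * p , b) j ⇔ Annihilates (Cyc M ×G Cyc p) (h , b) j
    ann⇔ j = ⇔-trans (annihilates-Cp^×Cp⇔ (suc m) j (h * p) b)
               (⇔-trans (c*m∣j*[h*c]⇔m∣j*h p M j h ×-⇔ ⇔-refl) (⇔-sym (annihilates-Cp^×Cp⇔ m j h b)))

  φCp^-suc : ∀ m → φCp^ (suc m) ≡ φCp^ m + (p ^ m * k) * (p ^ m * k)
  φCp^-suc m = begin
    phiG (Cyc N)                                ≡⟨ phiG-Cyc N ⟩
    ∑< N f                                      ≡⟨ cong (λ n → ∑< n f) (*-comm p M) ⟩
    ∑< (M * p) f                                ≡⟨ ∑<-multiples M k f-off ⟩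
    ∑< M (λ h → f (h * p)) + M * (k * (M * k))  ≡⟨ cong₂ _+_ (∑<-cong M (λ h _ → f-multiple h))
                                                             (sym (*-assoc M k (M * k))) ⟩
    ∑< M fM + M * k * (M * k)                   ≡⟨ cong (_+ M * k * (M * k)) (sym (phiG-Cyc M)) ⟩
    phiG (Cyc M) + M * k * (M * k)              ∎
    where
    open ≡-Reasoning
    N M : ℕ
    N = p ^ suc m
    M = p ^ m
    f fM : ℕ → ℕ
    f  g = totient (order (Cyc N) g)
    fM g = totient (order (Cyc M) g)
    f-off : ∀ g → ¬ p ∣ g → f g ≡ M * k
    f-off g p∤g = trans (cong totient (order-Cyc-¬∣ (suc m) p∤g)) (totient-p^[1+m] m)
    f-multiple : ∀ h → f (h * p) ≡ fM h
    f-multiple h = cong totient (order-Cyc-multiple m h)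

  φCp^×Cp-suc : ∀ m → φCp^×Cp (suc m) ≡ φCp^×Cp m + p * ((p ^ m * k) * (p ^ m * k))
  φCp^×Cp-suc m = begin
    phiG (Cyc N ×G Cyc p)                             ≡⟨ phiG-Cyc×Cyc N p ⟩
    ∑< N f                                            ≡⟨ cong (λ n → ∑< n f) (*-comm p M) ⟩
    ∑< (M * p) f                                      ≡⟨ ∑<-multiples M k f-off ⟩
    ∑< M (λ h → f (h * p)) + M * (k * (p * (M * k)))  ≡⟨ cong₂ _+_ (∑<-cong M (λ h _ → f-multiple h))
                                                                   (M*[k*[p*[M*k]]]≡p*[M*k*[M*k]] M k p) ⟩
    ∑< M fM + p * (M * k * (M * k))                   ≡⟨ cong (_+ p * (M * k * (M * k))) (sym (phiG-Cyc×Cyc M p)) ⟩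
    phiG (Cyc M ×G Cyc p) + p * (M * k * (M * k))     ∎
    where
    open ≡-Reasoning
    N = p ^ suc m
    M = p ^ m
    f fM : ℕ → ℕ
    f  a = ∑< p (λ b → totient (order (Cyc N ×G Cyc p) (a , b)))
    fM a = ∑< p (λ b → totient (order (Cyc M ×G Cyc p) (a , b)))

    f-off : ∀ a → ¬ p ∣ a → f a ≡ p * (M * k)
    f-off a p∤a = begin
      f a                 ≡⟨ ∑<-cong p (λ b _ → trans (cong totient (order-Cyc×Cp-¬∣ m b p∤a)) (totient-p^[1+m] m)) ⟩
      ∑< p (λ _ → M * k)  ≡⟨ ∑<-const p (M * k) ⟩
      p * (M * k)         ∎

    f-multiple : ∀ h → f (h * p) ≡ fM h
    f-multiple h = ∑<-cong p (λ b _ → cong totient (order-Cyc×Cp-multiple m h b))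

    M*[k*[p*[M*k]]]≡p*[M*k*[M*k]] : ∀ M k p → M * (k * (p * (M * k))) ≡ p * (M * k * (M * k))
    M*[k*[p*[M*k]]]≡p*[M*k*[M*k]] = solve-∀

  φCp^×Cp-zero : φCp^×Cp 0 ≡ φCp^ 1
  φCp^×Cp-zero = trans (phiG-Cyc1×Cyc p) (cong (phiG ∘ Cyc) (sym (*-identityʳ p)))

  φCp≡1+k*k : φCp^ 1 ≡ 1 + k * k
  φCp≡1+k*k = trans (φCp^-suc 0) (cong (λ x → 1 + x * x) (*-identityˡ k))

  φCp×Cp≡1+k*k+p*[k*k] : φCp^×Cp 1 ≡ 1 + k * k + p * (k * k)
  φCp×Cp≡1+k*k+p*[k*k] = trans (φCp^×Cp-suc 0)
    (cong₂ _+_ (trans φCp^×Cp-zero φCp≡1+k*k) (cong (λ x → p * (x * x)) (*-identityˡ k)))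

  φCp×Cp≤φCp^[1+n]×Cp : ∀ n → φCp^×Cp 1 ≤ φCp^×Cp (suc n)
  φCp×Cp≤φCp^[1+n]×Cp zero    = ≤-refl
  φCp×Cp≤φCp^[1+n]×Cp (suc n) = ≤-trans (φCp×Cp≤φCp^[1+n]×Cp n)
    (≤-trans (m≤m+n _ _) (≤-reflexive (sym (φCp^×Cp-suc (suc n)))))

  p*φCp^n×Cp≡φCp^[1+n]+k*φCp : ∀ n → p * φCp^×Cp n ≡ φCp^ (suc n) + k * φCp^ 1
  p*φCp^n×Cp≡φCp^[1+n]+k*φCp zero    = cong (p *_) φCp^×Cp-zero
  p*φCp^n×Cp≡φCp^[1+n]+k*φCp (suc n) = begin
    p * φCp^×Cp (suc n)                                ≡⟨ cong (p *_) (φCp^×Cp-suc n) ⟩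
    p * (φCp^×Cp n + p * (d * d))                      ≡⟨ *-distribˡ-+ p (φCp^×Cp n) _ ⟩
    p * φCp^×Cp n + p * (p * (d * d))                  ≡⟨ cong (_+ p * (p * (d * d))) (p*φCp^n×Cp≡φCp^[1+n]+k*φCp n) ⟩
    φCp^ (suc n) + c + p * (p * (d * d))               ≡⟨ regroup (φCp^ (suc n)) c p (p ^ n) k ⟩
    φCp^ (suc n) + (p ^ suc n * k) * (p ^ suc n * k) + c ≡⟨ cong (_+ c) (sym (φCp^-suc (suc n))) ⟩
    φCp^ (suc (suc n)) + c                             ∎
    where
    open ≡-Reasoning
    c d : ℕ
    c = k * φCp^ 1
    d = p ^ n * k
    regroup : ∀ a c p P k → a + c + p * (p * ((P * k) * (P * k))) ≡ a + (p * P * k) * (p * P * k) + c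
    regroup = solve-∀

  k*φCp<φCp^[1+n]×Cp : ∀ n → k * φCp^ 1 < φCp^×Cp (suc n)
  k*φCp<φCp^[1+n]×Cp n = begin-strict
    k * φCp^ 1               ≡⟨ cong (k *_) φCp≡1+k*k ⟩
    k * (1 + k * k)          <⟨ k*[1+k*k]<1+k*k+[1+k]*[k*k] k ⟩
    1 + k * k + p * (k * k)  ≡⟨ sym φCp×Cp≡1+k*k+p*[k*k] ⟩
    φCp^×Cp 1                ≤⟨ φCp×Cp≤φCp^[1+n]×Cp n ⟩
    φCp^×Cp (suc n)          ∎
    where open ≤-Reasoning

  φCp^[1+n]<p*φCp^n×Cp : ∀ n → φCp^ (suc n) < p * φCp^×Cp n
  φCp^[1+n]<p*φCp^n×Cp n = subst (φCp^ (suc n) <_) (sym (p*φCp^n×Cp≡φCp^[1+n]+k*φCp n))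
    (m<m+n (φCp^ (suc n)) (subst (0 <_) (sym (cong (k *_) φCp≡1+k*k)) (*-mono-≤ 1≤k (s≤s z≤n))))
    where
    1≤k : 1 ≤ k
    1≤k = s≤s⁻¹ (nonTrivial⇒n>1 p {{prime⇒nonTrivial isPrime}})

  k*φCp^[1+n]×Cp<φCp^[2+n] : ∀ n → k * φCp^×Cp (suc n) < φCp^ (suc (suc n))
  k*φCp^[1+n]×Cp<φCp^[2+n] n = +-cancelˡ-< B _ _ (begin-strict
    B + k * B      ≡⟨ p*φCp^n×Cp≡φCp^[1+n]+k*φCp (suc n) ⟩
    A + k * φCp^ 1 <⟨ +-monoʳ-< A (k*φCp<φCp^[1+n]×Cp n) ⟩
    A + B          ≡⟨ +-comm A B ⟩
    B + A          ∎)
    where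
    open ≤-Reasoning
    A B : ℕ
    A = φCp^ (suc (suc n))
    B = φCp^×Cp (suc n)

mainTheorem5 : (p m : ℕ) → Prime p → 2 ≤ m →
    ((p ∸ 2) * phiG (Cyc (p ^ (m ∸ 1)) ×G Cyc p) < phiG (Cyc (p ^ m)))
      × (phiG (Cyc (p ^ m)) < p * phiG (Cyc (p ^ (m ∸ 1)) ×G Cyc p))
mainTheorem5 0             _             ()    _
mainTheorem5 1             _             ()    _
mainTheorem5 (suc (suc q)) 1             _     (s≤s ())
mainTheorem5 (suc (suc q)) (suc (suc n)) isPrime _ =
    ≤-<-trans (*-monoˡ-≤ (φCp^×Cp isPrime (suc n)) (n≤1+n q)) (k*φCp^[1+n]×Cp<φCp^[2+n] isPrime n)
  , φCp^[1+n]<p*φCp^n×Cp isPrime (suc n)
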